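{- Let $r$ be a power of a prime, $k=\mathbb{F}_r(T)$, and let $\Pi$ denote the Carlitz factorial. Let the Bernoulli-Carlitz numbers $BC_n\in k$ be defined by $\frac{z}{e_C(z)}=\sum_{n=0}^\infty\frac{BC_n}{\Pi(n)}z^n$, where $e_C(z)=\sum_{j=0}^\infty \frac{z^{r^j}}{D_j}$. For $e\ge0$ let $\delta_e^*=\frac{1}{D_n}$ if $e=r^n-1$ for some $n\ge0$, and $\delta_e^*=0$ otherwise. Then for every $m\ge1$, $$BC_m=(-1)^m\Pi(m)\det\begin{pmatrix} \delta_1^*&1&&&\\ \delta_2^*&\delta_1^*&\ddots&&\\ \vdots&\vdots&\ddots&\ddots&\\ \delta_{m-1}^*&\delta_{m-2}^*&\cdots&\delta_1^*&1\\ \delta_m^*&\delta_{m-1}^*&\cdots&\delta_2^*&\delta_1^* \end{pmatrix},$$ the $m\times m$ matrix whose $(i,j)$ entry is $\delta^*_{i-j+1}$ for $i\ge j$, $1$ for $j=i+1$, and $0$ for $j>i+1$.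
   Context: For $i\ge1$ let $[i]=T^{r^i}-T$, and let $D_i=[i][i-1]^r\cdots[1]^{r^{i-1}}$ with $D_0=1$. For a nonnegative integer $n$ with base-$r$ expansion $n=\sum_{j=0}^m c_jr^j$ ($0\le c_j<r$), the Carlitz factorial is $\Pi(n)=\prod_{j=0}^m D_j^{c_j}$ (a nonzero element of $k$). -}

module Defs where

open import Level using (Level; _⊔_) renaming (suc to lsuc)
open import Algebra.Bundles using (CommutativeRing)
open import Data.Nat as ℕ using (ℕ; zero; suc; NonZero; _≤?_; _≟_)
open import Data.Nat.Primality using (Prime)
open import Data.Fin using (Fin; toℕ; punchIn) renaming (zero to fzero; suc to fsuc)
open import Data.List using (List; []; _∷_; map)
open import Data.List.Relation.Unary.All using (All)
open import Data.Maybe using (Maybe; just; nothing)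
open import Data.Product using (Σ; ∃; ∃₂; _×_; _,_)
open import Relation.Nullary using (¬_; yes; no)
open import Relation.Binary.PropositionalEquality using (_≡_)

-- Fields: a commutative ring with 0 ≉ 1 and a (total) inverse map that
-- is a two-sided inverse on every nonzero element (the value of 0⁻¹ is
-- irrelevant / unspecified).

record Field (c ℓ : Level) : Set (lsuc (c ⊔ ℓ)) where
  field
    commutativeRing : CommutativeRing c ℓ
  open CommutativeRing commutativeRing public
  field
    _⁻¹        : Carrier → Carrier
    ⁻¹-inverse : ∀ x → ¬ (x ≈ 0#) → x * (x ⁻¹) ≈ 1#
    0≉1        : ¬ (0# ≈ 1#)

module FieldOps {c ℓ : Level} (K : Field c ℓ) where
  open Field K

  pow : Carrier → ℕ → Carrier
  pow x zero    = 1#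
  pow x (suc n) = x * pow x n

  fromℕ : ℕ → Carrier
  fromℕ zero    = 0#
  fromℕ (suc n) = 1# + fromℕ n

  evalPoly : List Carrier → Carrier → Carrier
  evalPoly []       x = 0#
  evalPoly (a ∷ cs) x = a + x * evalPoly cs x

  sumRange : ℕ → (ℕ → Carrier) → Carrier
  sumRange zero    f = 0#
  sumRange (suc n) f = sumRange n f + f n

  prodRange : ℕ → (ℕ → Carrier) → Carrier
  prodRange zero    f = 1#
  prodRange (suc n) f = prodRange n f * f n

  sumFin : ∀ n → (Fin n → Carrier) → Carrier
  sumFin zero    f = 0#
  sumFin (suc n) f = f fzero + sumFin n (λ i → f (fsuc i))

  det : ∀ n → (Fin n → Fin n → Carrier) → Carrier
  det zero    M = 1#
  det (suc n) M =
    sumFin (suc n) (λ j →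
      pow (- 1#) (toℕ j) * (M fzero j * det n (λ a b → M (fsuc a) (punchIn j b))))

  PowerSeries : Set c
  PowerSeries = ℕ → Carrier

  _·ₚ_ : PowerSeries → PowerSeries → PowerSeries
  (f ·ₚ g) n = sumRange (suc n) (λ i → f i * g (n ℕ.∸ i))

  zₚ : PowerSeries
  zₚ (suc zero) = 1#
  zₚ _          = 0#

  _≈ₚ_ : PowerSeries → PowerSeries → Set ℓ
  f ≈ₚ g = ∀ n → f n ≈ g n

-- Exact logarithm: logExact r n = just j  iff  j is the least j ≤ n with
-- r ^ j ≡ n (for r ≥ 2 such a j is unique and necessarily ≤ n).

logSearch : ℕ → ℕ → ℕ → Maybe ℕ
logSearch r n zero with r ℕ.^ 0 ≟ n
... | yes _ = just 0
... | no  _ = nothing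
logSearch r n (suc b) with logSearch r n b
... | just j  = just j
... | nothing with r ℕ.^ suc b ≟ n
...   | yes _ = just (suc b)
...   | no  _ = nothing

logExact : ℕ → ℕ → Maybe ℕ
logExact r n = logSearch r n n

-- Characterisation (up to isomorphism) of k = 𝔽_r(T):
--  * r = p ^ (1+a) with p prime, and K has characteristic p;
--  * const : Fin r → K is injective with const i ^ r = const i, so its
--    image is exactly the subfield 𝔽_r = {x | x^r = x} of K;
--  * T is transcendental over 𝔽_r;
--  * K is generated by 𝔽_r and T: every x is f(T)/g(T) with g(T) ≠ 0.

record IsRationalFunctionField {c ℓ : Level} (K : Field c ℓ) (r : ℕ) : Set (c ⊔ ℓ) where
  open Field K
  open FieldOps K
  field
    p a       : ℕ
    p-prime   : Prime p
    r≡pᵃ      : r ≡ p ℕ.^ suc a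
    charp     : fromℕ p ≈ 0#
    T         : Carrier
    const     : Fin r → Carrier
    const-inj : ∀ i j → const i ≈ const j → i ≡ j
    const-fix : ∀ i → pow (const i) r ≈ const i
    transcendental : ∀ (cs : List (Fin r)) →
      evalPoly (map const cs) T ≈ 0# → All (λ i → const i ≈ 0#) cs
    generated : ∀ x → ∃₂ λ (f g : List (Fin r)) →
      (¬ (evalPoly (map const g) T ≈ 0#)) × (x * evalPoly (map const g) T ≈ evalPoly (map const f) T)

module Carlitz {c ℓ : Level} (K : Field c ℓ) (r : ℕ) .{{_ : NonZero r}}
               (H : IsRationalFunctionField K r) where
  open Field K
  open FieldOps K
  open IsRationalFunctionField H using (T)

  bracket : ℕ → Carrier
  bracket i = pow T (r ℕ.^ i) - T

  D : ℕ → Carrier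
  D i = prodRange i (λ k → pow (bracket (suc k)) (r ℕ.^ (i ℕ.∸ suc k)))

  digit : ℕ → ℕ → ℕ
  digit zero    n = n ℕ.% r
  digit (suc j) n = digit j (n ℕ./ r)

  -- Carlitz factorial Π(n) = Π_j D_j^{c_j}  (digits c_j with j > n vanish)
  Π : ℕ → Carrier
  Π n = prodRange (suc n) (λ j → pow (D j) (digit j n))

  eC : PowerSeries
  eC n with logExact r n
  ... | just j  = D j ⁻¹
  ... | nothing = 0#

  δ* : ℕ → Carrier
  δ* e with logExact r (suc e)
  ... | just n  = D n ⁻¹
  ... | nothing = 0#

  -- (i,j) entry (0-based) of the m×m Hessenberg matrix
  entry : ℕ → ℕ → Carrier
  entry i j with j ≤? i
  ... | yes _ = δ* (i ℕ.∸ j ℕ.+ 1)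
  ... | no  _ with j ≟ suc i
  ...   | yes _ = 1#
  ...   | no  _ = 0#

  hessenberg : ∀ m → Fin m → Fin m → Carrier
  hessenberg m i j = entry (toℕ i) (toℕ j)

  -- BC is a Bernoulli–Carlitz sequence:  z / e_C(z) = Σ BC_n/Π(n) z^n,
  -- i.e. (Σ BC_n/Π(n) z^n) · e_C(z) = z as formal power series.
  IsBernoulliCarlitz : (ℕ → Carrier) → Set ℓ
  IsBernoulliCarlitz BC = ((λ n → BC n * (Π n ⁻¹)) ·ₚ eC) ≈ₚ zₚ

{-# OPTIONS --safe #-}

-- Since e_C(z) = z · Σₑ δ*ₑ zᵉ, the defining identity says that aₙ = BCₙ / Π(n) are the
-- coefficients of the power-series inverse of Σₑ δ*ₑ zᵉ (whose constant term is δ*₀ = 1),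
-- and that inverse is unique. Expanding the Hessenberg determinant along its first row,
-- after generalising its first column to δ*ₛ, δ*ₛ₊₁, …, shows that (-1)ⁿ det Hₙ has the
-- same convolution with δ*. Finally Π(m) ≉ 0: T is nonzero and not a root of unity in a
-- field of characteristic p in which T is transcendental over 𝔽_r, so no [k] vanishes.
module Submission where

open import Defs
open import Level using (Level)
open import Data.Nat as ℕ using (ℕ; NonZero; zero; suc; _∸_; _^_; _≤_; _<_; _≥_; s≤s; s≤s⁻¹; _≤?_; _≟_)
import Data.Nat.Properties as ℕₚ
open ℕₚ using (≤-refl; *-mono-≤; m<n⇒m<1+n; n∸n≡0; +-∸-assoc)
open import Data.Nat.Induction using (<-rec)
open import Data.Fin using (Fin; toℕ; punchIn) renaming (zero to fzero; suc to fsuc)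
open import Data.Fin.Properties using (suc-injective)
open import Data.Vec using (Vec; []; _∷_)
open import Data.List using ([]; _∷_; map; replicate)
open import Data.List.Properties using (map-replicate)
open import Data.List.Relation.Unary.All using (All; []; _∷_)
open import Data.List.Relation.Unary.All.Properties using (replicate⁻)
open import Data.Nat.Primality using (prime⇒nonTrivial)
open import Data.Maybe using (just; nothing)
open import Data.Empty using (⊥-elim)
open import Function.Definitions using (Injective)
open import Relation.Nullary using (¬_; yes; no)
open import Relation.Binary.PropositionalEquality as ≡ using (_≡_)

module FieldProperties {c ℓ : Level} (K : Field c ℓ) where
  open Field K
  open FieldOps K
  open import Algebra.Properties.Ring ring using (-‿distribˡ-*; -‿distribʳ-*; -1*x≈-x)
  open import Algebra.Properties.AbelianGroup +-abelianGroup
    using (⁻¹-involutive; x∙y⁻¹≈ε⇒x≈y) renaming (∙-cancelˡ to +-cancelˡ)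
  open import Algebra.Solver.Ring.NaturalCoefficients.Default commutativeSemiring
    using (solve; _:+_; _:*_; _:=_; con)
  open import Relation.Binary.Reasoning.Setoid setoid

  ≡⇒≈ : ∀ {x y} → x ≡ y → x ≈ y
  ≡⇒≈ ≡.refl = refl

  1≉0 : ¬ 1# ≈ 0#
  1≉0 1≈0 = 0≉1 (sym 1≈0)

  injective-not-all-zero : ∀ {n} → 2 ≤ n → (f : Fin n → Carrier) → Injective _≡_ _≈_ f → ¬ (∀ i → f i ≈ 0#)
  injective-not-all-zero {suc zero} (s≤s ())
  injective-not-all-zero {suc (suc _)} _ f f-inj f≈0 with f-inj (trans (f≈0 fzero) (sym (f≈0 (fsuc fzero))))
  ... | ()

  x-y≈0⇒x≈y : ∀ x y → x - y ≈ 0# → x ≈ y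
  x-y≈0⇒x≈y = x∙y⁻¹≈ε⇒x≈y

  -x*-y≈x*y : ∀ x y → (- x) * (- y) ≈ x * y
  -x*-y≈x*y x y = begin
    (- x) * (- y)    ≈⟨ -‿distribˡ-* x (- y) ⟨
    - (x * - y)      ≈⟨ -‿cong (-‿distribʳ-* x y) ⟨
    - - (x * y)      ≈⟨ ⁻¹-involutive _ ⟩
    x * y            ∎

  *-cancelˡ : ∀ x {y z} → ¬ x ≈ 0# → x * y ≈ x * z → y ≈ z
  *-cancelˡ x {y} {z} x≉0 xy≈xz = begin
    y                ≈⟨ unit y ⟩
    x ⁻¹ * (x * y)   ≈⟨ *-congˡ xy≈xz ⟩
    x ⁻¹ * (x * z)   ≈⟨ unit z ⟨
    z                ∎
    where
    unit : ∀ w → w ≈ x ⁻¹ * (x * w)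
    unit w = begin
      w                 ≈⟨ *-identityˡ w ⟨
      1# * w            ≈⟨ *-congʳ (⁻¹-inverse x x≉0) ⟨
      (x * x ⁻¹) * w    ≈⟨ solve 3 (λ x i w → (x :* i) :* w := i :* (x :* w)) refl x (x ⁻¹) w ⟩
      x ⁻¹ * (x * w)    ∎

  *-nonzero : ∀ {x y} → ¬ x ≈ 0# → ¬ y ≈ 0# → ¬ x * y ≈ 0#
  *-nonzero {x} {y} x≉0 y≉0 xy≈0 = y≉0 (*-cancelˡ x x≉0 (trans xy≈0 (sym (zeroʳ x))))

  pow-nonzero : ∀ {x} → ¬ x ≈ 0# → ∀ n → ¬ pow x n ≈ 0#
  pow-nonzero x≉0 zero    = 1≉0
  pow-nonzero x≉0 (suc n) = *-nonzero x≉0 (pow-nonzero x≉0 n)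

  prodRange-nonzero : ∀ n f → (∀ i → ¬ f i ≈ 0#) → ¬ prodRange n f ≈ 0#
  prodRange-nonzero zero    f f≉0 = 1≉0
  prodRange-nonzero (suc n) f f≉0 = *-nonzero (prodRange-nonzero n f f≉0) (f≉0 n)

  x≈x*y⁻¹*y : ∀ x {y} → ¬ y ≈ 0# → x ≈ (x * y ⁻¹) * y
  x≈x*y⁻¹*y x {y} y≉0 = begin
    x                ≈⟨ *-identityʳ x ⟨
    x * 1#           ≈⟨ *-congˡ (⁻¹-inverse y y≉0) ⟨
    x * (y * y ⁻¹)   ≈⟨ solve 3 (λ x y i → x :* (y :* i) := (x :* i) :* y) refl x y (y ⁻¹) ⟩
    (x * y ⁻¹) * y   ∎

  1⁻¹≈1 : 1# ⁻¹ ≈ 1#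
  1⁻¹≈1 = trans (sym (*-identityˡ _)) (⁻¹-inverse 1# 1≉0)

  -- Sums, signs and determinants

  sumRange-cong : ∀ n {f g : ℕ → Carrier} → (∀ {i} → i < n → f i ≈ g i) → sumRange n f ≈ sumRange n g
  sumRange-cong zero    f≈g = refl
  sumRange-cong (suc n) f≈g = +-cong (sumRange-cong n (λ i<n → f≈g (m<n⇒m<1+n i<n))) (f≈g ≤-refl)

  sumFin-cong : ∀ n {f g : Fin n → Carrier} → (∀ i → f i ≈ g i) → sumFin n f ≈ sumFin n g
  sumFin-cong zero    f≈g = refl
  sumFin-cong (suc n) f≈g = +-cong (f≈g fzero) (sumFin-cong n (λ i → f≈g (fsuc i)))

  sumFin-zero : ∀ n {f : Fin n → Carrier} → (∀ i → f i ≈ 0#) → sumFin n f ≈ 0#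
  sumFin-zero zero    f≈0 = refl
  sumFin-zero (suc n) f≈0 = trans (+-cong (f≈0 fzero) (sumFin-zero n (λ i → f≈0 (fsuc i)))) (+-identityˡ 0#)

  det-cong : ∀ n {M N : Fin n → Fin n → Carrier} → (∀ i j → M i j ≈ N i j) → det n M ≈ det n N
  det-cong zero    M≈N = refl
  det-cong (suc n) M≈N = sumFin-cong (suc n) (λ j →
    *-congˡ {pow (- 1#) (toℕ j)} (*-cong (M≈N fzero j) (det-cong n (λ a b → M≈N (fsuc a) (punchIn j b)))))

  det-firstRow-two : ∀ n (M : Fin (suc (suc n)) → Fin (suc (suc n)) → Carrier) →
                     (∀ j → M fzero (fsuc (fsuc j)) ≈ 0#) →
                     det (suc (suc n)) M ≈ M fzero fzero * det (suc n) (λ a b → M (fsuc a) (fsuc b))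
                                          - M fzero (fsuc fzero) * det (suc n) (λ a b → M (fsuc a) (punchIn (fsuc fzero) b))
  det-firstRow-two n M M₀≈0 = begin
    1# * (M₀₀ * minor₀) + ((- 1# * 1#) * (M₀₁ * minor₁) + rest)
      ≈⟨ +-cong (*-identityˡ _) (+-cong (trans (*-congʳ (*-identityʳ _)) (-1*x≈-x _)) rest≈0) ⟩
    M₀₀ * minor₀ + (- (M₀₁ * minor₁) + 0#)   ≈⟨ +-congˡ (+-identityʳ _) ⟩
    M₀₀ * minor₀ - M₀₁ * minor₁               ∎
    where
    M₀₀ = M fzero fzero
    M₀₁ = M fzero (fsuc fzero)
    minor₀ = det (suc n) (λ a b → M (fsuc a) (fsuc b))
    minor₁ = det (suc n) (λ a b → M (fsuc a) (punchIn (fsuc fzero) b))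
    rest = sumFin n (λ j → pow (- 1#) (toℕ (fsuc (fsuc j))) *
                           (M fzero (fsuc (fsuc j)) * det (suc n) (λ a b → M (fsuc a) (punchIn (fsuc (fsuc j)) b))))
    rest≈0 : rest ≈ 0#
    rest≈0 = sumFin-zero n (λ j → trans (*-congˡ (trans (*-congʳ (M₀≈0 j)) (zeroˡ _))) (zeroʳ _))

  sign : ℕ → Carrier
  sign = pow (- 1#)

  sign-suc : ∀ n → sign (suc n) ≈ - sign n
  sign-suc n = -1*x≈-x (sign n)

  sign-suc-*-sub : ∀ n x y → sign (suc n) * (x - y) ≈ sign (suc n) * x + sign n * y
  sign-suc-*-sub n x y = begin
    sign (suc n) * (x - y)                  ≈⟨ distribˡ _ x (- y) ⟩
    sign (suc n) * x + sign (suc n) * - y   ≈⟨ +-congˡ (*-congʳ (sign-suc n)) ⟩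
    sign (suc n) * x + (- sign n) * (- y)   ≈⟨ +-congˡ (-x*-y≈x*y (sign n) y) ⟩
    sign (suc n) * x + sign n * y           ∎

  -- Polynomials

  evalPoly-replicate-+ : ∀ c x d L → evalPoly (replicate (d ℕ.+ L) c) x ≈
                         evalPoly (replicate d c) x + pow x d * evalPoly (replicate L c) x
  evalPoly-replicate-+ c x zero    L = sym (trans (+-identityˡ _) (*-identityˡ _))
  evalPoly-replicate-+ c x (suc d) L = begin
    c + x * evalPoly (replicate (d ℕ.+ L) c) x  ≈⟨ +-congˡ (*-congˡ (evalPoly-replicate-+ c x d L)) ⟩
    c + x * (e d + pow x d * e L)
      ≈⟨ solve 5 (λ c x u v w → c :+ x :* (u :+ v :* w) := (c :+ x :* u) :+ (x :* v) :* w)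
               refl c x (e d) (pow x d) (e L) ⟩
    (c + x * e d) + (x * pow x d) * e L        ∎
    where
    e : ℕ → Carrier
    e n = evalPoly (replicate n c) x

  evalPoly-replicate-* : ∀ c x d → pow x d ≈ 1# → ∀ k →
                         evalPoly (replicate (k ℕ.* d) c) x ≈ fromℕ k * evalPoly (replicate d c) x
  evalPoly-replicate-* c x d xᵈ≈1 zero    = sym (zeroˡ _)
  evalPoly-replicate-* c x d xᵈ≈1 (suc k) = begin
    e (d ℕ.+ k ℕ.* d)              ≈⟨ evalPoly-replicate-+ c x d (k ℕ.* d) ⟩
    e d + pow x d * e (k ℕ.* d)    ≈⟨ +-congˡ (*-cong xᵈ≈1 (evalPoly-replicate-* c x d xᵈ≈1 k)) ⟩
    e d + 1# * (fromℕ k * e d)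
      ≈⟨ solve 2 (λ u v → u :+ con 1 :* (v :* u) := (con 1 :+ v) :* u) refl (e d) (fromℕ k) ⟩
    (1# + fromℕ k) * e d           ∎
    where
    e : ℕ → Carrier
    e n = evalPoly (replicate n c) x

  [x-a]y+ay≈xy : ∀ x a y → (x - a) * y + a * y ≈ x * y
  [x-a]y+ay≈xy x a y = begin
    (x - a) * y + a * y  ≈⟨ distribʳ y (x - a) a ⟨
    (x - a + a) * y      ≈⟨ *-congʳ (+-assoc x (- a) a) ⟩
    (x + (- a + a)) * y  ≈⟨ *-congʳ (+-congˡ (-‿inverseˡ a)) ⟩
    (x + 0#) * y         ≈⟨ *-congʳ (+-identityʳ x) ⟩
    x * y                ∎

  evalMonic : ∀ {n} → Vec Carrier n → Carrier → Carrier
  evalMonic []       x = 1#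
  evalMonic (c ∷ cs) x = c + x * evalMonic cs x

  deflate : ∀ {n} → Carrier → Vec Carrier (suc n) → Vec Carrier n
  deflate a (c ∷ [])     = []
  deflate a (c ∷ d ∷ cs) = evalMonic (d ∷ cs) a ∷ deflate a (d ∷ cs)

  evalMonic-deflate : ∀ {n} a (cs : Vec Carrier (suc n)) x →
                      evalMonic cs x ≈ (x - a) * evalMonic (deflate a cs) x + evalMonic cs a
  evalMonic-deflate a (c ∷ []) x = begin
    c + x * 1#                         ≈⟨ +-congˡ ([x-a]y+ay≈xy x a 1#) ⟨
    c + ((x - a) * 1# + a * 1#)        ≈⟨ solve 3 (λ c u v → c :+ (u :+ v) := u :+ (c :+ v)) refl c _ _ ⟩
    (x - a) * 1# + (c + a * 1#)        ∎
  evalMonic-deflate a (c ∷ d ∷ cs) x = begin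
    c + x * q x                        ≈⟨ +-congˡ (*-congˡ (evalMonic-deflate a (d ∷ cs) x)) ⟩
    c + x * ((x - a) * q′ + q a)
      ≈⟨ solve 5 (λ c x u Q R → c :+ x :* (u :* Q :+ R) := (c :+ x :* (u :* Q)) :+ x :* R)
               refl c x (x - a) q′ (q a) ⟩
    (c + x * ((x - a) * q′)) + x * q a ≈⟨ +-congˡ ([x-a]y+ay≈xy x a (q a)) ⟨
    (c + x * ((x - a) * q′)) + ((x - a) * q a + a * q a)
      ≈⟨ solve 6 (λ c x u Q R a → (c :+ x :* (u :* Q)) :+ (u :* R :+ a :* R) := u :* (R :+ x :* Q) :+ (c :+ a :* R))
               refl c x (x - a) q′ (q a) a ⟩
    (x - a) * (q a + x * q′) + (c + a * q a) ∎
    where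
    q : Carrier → Carrier
    q = evalMonic (d ∷ cs)
    q′ : Carrier
    q′ = evalMonic (deflate a (d ∷ cs)) x

  evalMonic-roots≤degree : ∀ n (cs : Vec Carrier n) (ρ : Fin (suc n) → Carrier) → Injective _≡_ _≈_ ρ →
                           ¬ (∀ i → evalMonic cs (ρ i) ≈ 0#)
  evalMonic-roots≤degree zero    []       ρ ρ-inj roots = 1≉0 (roots fzero)
  evalMonic-roots≤degree (suc n) (c ∷ cs) ρ ρ-inj roots =
    evalMonic-roots≤degree n (deflate a (c ∷ cs)) (λ i → ρ (fsuc i)) (λ eq → suc-injective (ρ-inj eq)) deflatedRoot
    where
    a = ρ fzero
    deflatedRoot : ∀ i → evalMonic (deflate a (c ∷ cs)) (ρ (fsuc i)) ≈ 0#
    deflatedRoot i = *-cancelˡ (x - a) x-a≉0 (begin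
      (x - a) * q                               ≈⟨ +-identityʳ _ ⟨
      (x - a) * q + 0#                          ≈⟨ +-congˡ (roots fzero) ⟨
      (x - a) * q + evalMonic (c ∷ cs) a        ≈⟨ evalMonic-deflate a (c ∷ cs) x ⟨
      evalMonic (c ∷ cs) x                      ≈⟨ roots (fsuc i) ⟩
      0#                                        ≈⟨ zeroʳ _ ⟨
      (x - a) * 0#                              ∎)
      where
      x = ρ (fsuc i)
      q = evalMonic (deflate a (c ∷ cs)) x
      x-a≉0 : ¬ x - a ≈ 0#
      x-a≉0 x-a≈0 with ρ-inj (x-y≈0⇒x≈y x a x-a≈0)
      ... | ()

  zeros : ∀ k → Vec Carrier k
  zeros zero    = []
  zeros (suc k) = 0# ∷ zeros k

  evalMonic-zeros : ∀ k x → evalMonic (zeros k) x ≈ pow x k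
  evalMonic-zeros zero    x = refl
  evalMonic-zeros (suc k) x = trans (+-identityˡ _) (*-congˡ (evalMonic-zeros k x))

  -- The nonzero solutions of x ^ n ≈ x are roots of the monic X ^ (n - 1) - 1.
  pow-fixedPoints-contain-zero : ∀ n → 2 ≤ n → (ρ : Fin n → Carrier) → Injective _≡_ _≈_ ρ →
                                 (∀ i → pow (ρ i) n ≈ ρ i) → ¬ (∀ i → ¬ ρ i ≈ 0#)
  pow-fixedPoints-contain-zero (suc zero) (s≤s ())
  pow-fixedPoints-contain-zero (suc (suc k)) _ ρ ρ-inj fixed nonzero =
    evalMonic-roots≤degree (suc k) (- 1# ∷ zeros k) ρ ρ-inj root
    where
    root : ∀ i → evalMonic (- 1# ∷ zeros k) (ρ i) ≈ 0#
    root i = begin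
      - 1# + ρ i * evalMonic (zeros k) (ρ i)  ≈⟨ +-congˡ (*-congˡ (evalMonic-zeros k (ρ i))) ⟩
      - 1# + pow (ρ i) (suc k)
        ≈⟨ +-congˡ (*-cancelˡ (ρ i) (nonzero i) (trans (fixed i) (sym (*-identityʳ _)))) ⟩
      - 1# + 1#                               ≈⟨ -‿inverseˡ 1# ⟩
      0#                                      ∎

  -- Power series

  oneₚ : PowerSeries
  oneₚ zero    = 1#
  oneₚ (suc _) = 0#

  ·ₚ-lastTerm : ∀ {g : PowerSeries} → g 0 ≈ 1# → ∀ x n → x * g (n ∸ n) ≈ x
  ·ₚ-lastTerm {g} g₀≈1 x n = trans (*-congˡ (trans (≡⇒≈ (≡.cong g (n∸n≡0 n))) g₀≈1)) (*-identityʳ x)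

  ·ₚ-shift : ∀ {f g h : PowerSeries} → g 0 ≈ 0# → (∀ e → g (suc e) ≈ h e) → ∀ n → (f ·ₚ g) (suc n) ≈ (f ·ₚ h) n
  ·ₚ-shift {f} {g} {h} g₀≈0 g₊≈h n = begin
    sumRange (suc n) (λ i → f i * g (suc n ∸ i)) + f (suc n) * g (n ∸ n)
      ≈⟨ +-cong (sumRange-cong (suc n) (λ i<1+n → *-congˡ (shifted i<1+n)))
                (*-congˡ (trans (≡⇒≈ (≡.cong g (n∸n≡0 n))) g₀≈0)) ⟩
    (f ·ₚ h) n + f (suc n) * 0#   ≈⟨ trans (+-congˡ (zeroʳ _)) (+-identityʳ _) ⟩
    (f ·ₚ h) n                    ∎
    where
    shifted : ∀ {i} → i < suc n → g (suc n ∸ i) ≈ h (n ∸ i)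
    shifted {i} i<1+n = trans (≡⇒≈ (≡.cong g (+-∸-assoc 1 (s≤s⁻¹ i<1+n)))) (g₊≈h (n ∸ i))

  ·ₚ-inverse-unique : ∀ {a a′ b : PowerSeries} → b 0 ≈ 1# → (a ·ₚ b) ≈ₚ oneₚ → (a′ ·ₚ b) ≈ₚ oneₚ → a ≈ₚ a′
  ·ₚ-inverse-unique {a} {a′} {b} b₀≈1 ab≈1 a′b≈1 = <-rec _ agree
    where
    lastTerm : ∀ x n → x * b (n ∸ n) ≈ x
    lastTerm = ·ₚ-lastTerm {b} b₀≈1
    agree : ∀ n → (∀ {i} → i < n → a i ≈ a′ i) → a n ≈ a′ n
    agree zero _ = begin
      a 0            ≈⟨ lastTerm (a 0) 0 ⟨
      a 0 * b 0      ≈⟨ +-identityˡ _ ⟨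
      (a ·ₚ b) 0     ≈⟨ trans (ab≈1 0) (sym (a′b≈1 0)) ⟩
      (a′ ·ₚ b) 0    ≈⟨ +-identityˡ _ ⟩
      a′ 0 * b 0     ≈⟨ lastTerm (a′ 0) 0 ⟩
      a′ 0           ∎
    agree (suc n) ih = begin
      a (suc n)                ≈⟨ lastTerm _ n ⟨
      a (suc n) * b (n ∸ n)    ≈⟨ +-cancelˡ (S a) _ _ (begin
        (a ·ₚ b) (suc n)          ≈⟨ trans (ab≈1 (suc n)) (sym (a′b≈1 (suc n))) ⟩
        (a′ ·ₚ b) (suc n)         ≈⟨ +-congʳ (sumRange-cong (suc n) (λ i<1+n → *-congʳ (sym (ih i<1+n)))) ⟩
        S a + a′ (suc n) * b (n ∸ n) ∎) ⟩
      a′ (suc n) * b (n ∸ n)   ≈⟨ lastTerm _ n ⟩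
      a′ (suc n)               ∎
      where
      S : PowerSeries → Carrier
      S c = sumRange (suc n) (λ i → c i * b (suc n ∸ i))


2≤m^[1+n] : ∀ {m} n → 2 ≤ m → 2 ≤ m ^ suc n
2≤m^[1+n] {m@(suc _)} n 2≤m = *-mono-≤ 2≤m (ℕₚ.m^n>0 m n)

module CarlitzProperties {c ℓ : Level} (K : Field c ℓ) (r : ℕ) .{{_ : NonZero r}}
                         (H : IsRationalFunctionField K r) where
  open Field K
  open FieldOps K
  open FieldProperties K
  open Carlitz K r H
  open IsRationalFunctionField H using (T; p; a; p-prime; r≡pᵃ; charp; const; const-inj; const-fix; transcendental)
  open import Algebra.Solver.Ring.NaturalCoefficients.Default commutativeSemiring
    using (solve; _:+_; _:*_; _:=_; con)
  open import Algebra.Properties.Ring ring using (-1*x≈-x)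
  open import Relation.Binary.Reasoning.Setoid setoid

  -- Nonvanishing of Π

  p≥2 : 2 ≤ p
  p≥2 = ℕ.nonTrivial⇒n>1 p {{prime⇒nonTrivial p-prime}}

  r≥2 : 2 ≤ r
  r≥2 = ≡.subst (2 ≤_) (≡.sym r≡pᵃ) (2≤m^[1+n] a p≥2)

  const-injective : Injective _≡_ _≈_ const
  const-injective = const-inj _ _

  const-not-all-zero : ¬ (∀ u → const u ≈ 0#)
  const-not-all-zero = injective-not-all-zero r≥2 const const-injective

  -- If T ≈ 0, a vanishing const z would make every const z + const u · T vanish, forcing const u ≈ 0.
  T≉0 : ¬ T ≈ 0#
  T≉0 T≈0 = pow-fixedPoints-contain-zero r r≥2 const const-injective const-fix const≉0
    where
    const≉0 : ∀ z → ¬ const z ≈ 0#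
    const≉0 z cz≈0 = const-not-all-zero (λ u →
      second (transcendental (z ∷ u ∷ []) (trans (+-cong cz≈0 (trans (*-congʳ T≈0) (zeroˡ _))) (+-identityˡ 0#))))
      where
      second : ∀ {u} → All (λ i → const i ≈ 0#) (z ∷ u ∷ []) → const u ≈ 0#
      second (_ ∷ cu≈0 ∷ []) = cu≈0

  -- If T ^ d ≈ 1, then u + u T + ⋯ + u T ^ (p d - 1) ≈ p (u + ⋯ + u T ^ (d - 1)) ≈ 0.
  T-not-root-of-unity : ∀ d → ¬ pow T (suc d) ≈ 1#
  T-not-root-of-unity d Tᵈ≈1 = const-not-all-zero (const≈0 p≥2 charp)
    where
    const≈0 : ∀ {q} → 2 ≤ q → fromℕ q ≈ 0# → ∀ u → const u ≈ 0#
    const≈0 {suc q} _ q≈0 u = replicate⁻ (transcendental (replicate (suc q ℕ.* suc d) u) (begin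
      evalPoly (map const (replicate (suc q ℕ.* suc d) u)) T
        ≈⟨ ≡⇒≈ (≡.cong (λ cs → evalPoly cs T) (map-replicate const (suc q ℕ.* suc d) u)) ⟩
      evalPoly (replicate (suc q ℕ.* suc d) (const u)) T     ≈⟨ evalPoly-replicate-* (const u) T (suc d) Tᵈ≈1 (suc q) ⟩
      fromℕ (suc q) * evalPoly (replicate (suc d) (const u)) T  ≈⟨ *-congʳ q≈0 ⟩
      0# * evalPoly (replicate (suc d) (const u)) T          ≈⟨ zeroˡ _ ⟩
      0#                                                     ∎))

  Tᴺ≉T : ∀ {N} → 2 ≤ N → ¬ pow T N ≈ T
  Tᴺ≉T {suc zero}    (s≤s ())
  Tᴺ≉T {suc (suc d)} _ Tᴺ≈T = T-not-root-of-unity d (*-cancelˡ T T≉0 (trans Tᴺ≈T (sym (*-identityʳ T))))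

  bracket≉0 : ∀ k → ¬ bracket (suc k) ≈ 0#
  bracket≉0 k [1+k]≈0 = Tᴺ≉T (2≤m^[1+n] k r≥2) (x-y≈0⇒x≈y _ T [1+k]≈0)

  D≉0 : ∀ j → ¬ D j ≈ 0#
  D≉0 j = prodRange-nonzero j _ (λ k → pow-nonzero (bracket≉0 k) (r ^ (j ∸ suc k)))

  Π≉0 : ∀ n → ¬ Π n ≈ 0#
  Π≉0 n = prodRange-nonzero (suc n) _ (λ j → pow-nonzero (D≉0 j) (digit j n))

  -- The Hessenberg determinant

  entry-suc-suc : ∀ i j → entry (suc i) (suc j) ≡ entry i j
  entry-suc-suc i j with suc j ≤? suc i | j ≤? i
  ... | yes _   | yes _   = ≡.refl
  ... | yes j≤i | no  j≰i = ⊥-elim (j≰i (s≤s⁻¹ j≤i))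
  ... | no  j≰i | yes j≤i = ⊥-elim (j≰i (s≤s j≤i))
  ... | no  _   | no  _ with suc j ≟ suc (suc i) | j ≟ suc i
  ...   | yes _   | yes _   = ≡.refl
  ...   | yes j≡i | no  j≢i = ⊥-elim (j≢i (ℕₚ.suc-injective j≡i))
  ...   | no  j≢i | yes j≡i = ⊥-elim (j≢i (≡.cong suc j≡i))
  ...   | no  _   | no  _   = ≡.refl

  shiftedEntry : ℕ → ℕ → ℕ → Carrier
  shiftedEntry s i zero    = δ* (i ℕ.+ s)
  shiftedEntry s i (suc j) = entry i (suc j)

  shiftedHessenberg : ℕ → ∀ n → Fin n → Fin n → Carrier
  shiftedHessenberg s n i j = shiftedEntry s (toℕ i) (toℕ j)

  entry≡shiftedEntry₁ : ∀ i j → entry i j ≡ shiftedEntry 1 i j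
  entry≡shiftedEntry₁ i zero    = ≡.refl
  entry≡shiftedEntry₁ i (suc j) = ≡.refl

  det-shiftedHessenberg-expand : ∀ s n →
    det (suc (suc n)) (shiftedHessenberg s (suc (suc n))) ≈
    δ* s * det (suc n) (hessenberg (suc n)) - det (suc n) (shiftedHessenberg (suc s) (suc n))
  det-shiftedHessenberg-expand s n = begin
    det (suc (suc n)) (shiftedHessenberg s (suc (suc n)))
      ≈⟨ det-firstRow-two n (shiftedHessenberg s (suc (suc n))) (λ _ → refl) ⟩
    δ* s * minor₀ - 1# * minor₁
      ≈⟨ +-cong (*-congˡ minor₀≈) (-‿cong (trans (*-identityˡ _) minor₁≈)) ⟩
    δ* s * det (suc n) (hessenberg (suc n)) - det (suc n) (shiftedHessenberg (suc s) (suc n)) ∎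
    where
    minor₀ = det (suc n) (λ a b → shiftedEntry s (suc (toℕ a)) (suc (toℕ b)))
    minor₁ = det (suc n) (λ a b → shiftedEntry s (suc (toℕ a)) (toℕ (punchIn (fsuc fzero) b)))
    minor₀≈ : minor₀ ≈ det (suc n) (hessenberg (suc n))
    minor₀≈ = det-cong (suc n) (λ a b → ≡⇒≈ (entry-suc-suc (toℕ a) (toℕ b)))
    minor₁-entry : ∀ a b → shiftedEntry s (suc (toℕ a)) (toℕ (punchIn (fsuc fzero) b)) ≈ shiftedHessenberg (suc s) (suc n) a b
    minor₁-entry a fzero    = ≡⇒≈ (≡.cong δ* (≡.sym (ℕₚ.+-suc (toℕ a) s)))
    minor₁-entry a (fsuc b) = ≡⇒≈ (entry-suc-suc (toℕ a) (suc (toℕ b)))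
    minor₁≈ : minor₁ ≈ det (suc n) (shiftedHessenberg (suc s) (suc n))
    minor₁≈ = det-cong (suc n) minor₁-entry

  signedDet : PowerSeries
  signedDet n = sign n * det n (hessenberg n)

  signedDet-shifted : ∀ s n → sign n * det (suc n) (shiftedHessenberg s (suc n)) ≈
                             sumRange (suc n) (λ i → signedDet i * δ* (s ℕ.+ n ∸ i))
  signedDet-shifted s zero = begin
    1# * (1# * (δ* s * 1#) + 0#)
      ≈⟨ solve 1 (λ d → con 1 :* (con 1 :* (d :* con 1) :+ con 0) := con 0 :+ (con 1 :* con 1) :* d)
               refl (δ* s) ⟩
    0# + (1# * 1#) * δ* s           ≈⟨ +-congˡ (*-congˡ (≡⇒≈ (≡.cong δ* (≡.sym (ℕₚ.+-identityʳ s))))) ⟩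
    0# + (1# * 1#) * δ* (s ℕ.+ 0)   ∎
  signedDet-shifted s (suc n) = begin
    sign (suc n) * det (suc (suc n)) (shiftedHessenberg s (suc (suc n)))
      ≈⟨ *-congˡ (det-shiftedHessenberg-expand s n) ⟩
    sign (suc n) * (δ* s * Δ - det (suc n) (shiftedHessenberg (suc s) (suc n)))
      ≈⟨ sign-suc-*-sub n _ _ ⟩
    sign (suc n) * (δ* s * Δ) + sign n * det (suc n) (shiftedHessenberg (suc s) (suc n))
      ≈⟨ +-cong (solve 3 (λ σ d h → σ :* (d :* h) := (σ :* h) :* d)
                       refl (sign (suc n)) (δ* s) Δ) (signedDet-shifted (suc s) n) ⟩
    signedDet (suc n) * δ* s + sumRange (suc n) (λ i → signedDet i * δ* (suc s ℕ.+ n ∸ i))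
      ≈⟨ +-comm _ _ ⟩
    sumRange (suc n) (λ i → signedDet i * δ* (suc s ℕ.+ n ∸ i)) + signedDet (suc n) * δ* s
      ≈⟨ +-cong (sumRange-cong (suc n) (λ {i} _ → *-congˡ (≡⇒≈ (≡.cong (λ k → δ* (k ∸ i)) (≡.sym (ℕₚ.+-suc s n))))))
                (*-congˡ (≡⇒≈ (≡.cong δ* (≡.sym (ℕₚ.m+n∸n≡m s (suc n)))))) ⟩
    sumRange (suc n) (λ i → signedDet i * δ* (s ℕ.+ suc n ∸ i)) + signedDet (suc n) * δ* (s ℕ.+ suc n ∸ suc n) ∎
    where
    Δ = det (suc n) (hessenberg (suc n))

  δ*₀≈1 : δ* 0 ≈ 1#
  δ*₀≈1 = 1⁻¹≈1

  signedDet·δ*≈1 : (signedDet ·ₚ δ*) ≈ₚ oneₚ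
  signedDet·δ*≈1 zero = trans (+-identityˡ _) (trans (*-congʳ (*-identityˡ 1#)) (trans (*-identityˡ _) δ*₀≈1))
  signedDet·δ*≈1 (suc n) = begin
    sumRange (suc n) (λ i → signedDet i * δ* (suc n ∸ i)) + signedDet (suc n) * δ* (n ∸ n)
      ≈⟨ +-cong (sym (signedDet-shifted 1 n)) (·ₚ-lastTerm {δ*} δ*₀≈1 _ n) ⟩
    sign n * det (suc n) (shiftedHessenberg 1 (suc n)) + (- 1# * sign n) * Δ
      ≈⟨ +-cong (*-congˡ (det-cong (suc n) (λ i j → ≡⇒≈ (≡.sym (entry≡shiftedEntry₁ (toℕ i) (toℕ j))))))
                (trans (*-assoc _ _ _) (-1*x≈-x _)) ⟩
    sign n * Δ - sign n * Δ   ≈⟨ -‿inverseʳ _ ⟩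
    0#                        ∎
    where
    Δ = det (suc n) (hessenberg (suc n))

  -- Bernoulli–Carlitz numbers

  eC-suc : ∀ e → eC (suc e) ≡ δ* e
  eC-suc e with logExact r (suc e)
  ... | just _  = ≡.refl
  ... | nothing = ≡.refl

  zₚ-suc : ∀ n → zₚ (suc n) ≈ oneₚ n
  zₚ-suc zero    = refl
  zₚ-suc (suc n) = refl

  bernoulliCarlitz·δ*≈1 : ∀ {BC} → IsBernoulliCarlitz BC → ((λ n → BC n * Π n ⁻¹) ·ₚ δ*) ≈ₚ oneₚ
  bernoulliCarlitz·δ*≈1 {BC} isBC n = begin
    ((λ n → BC n * Π n ⁻¹) ·ₚ δ*) n          ≈⟨ ·ₚ-shift {λ n → BC n * Π n ⁻¹} {eC} refl (λ e → ≡⇒≈ (eC-suc e)) n ⟨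
    ((λ n → BC n * Π n ⁻¹) ·ₚ eC) (suc n)    ≈⟨ isBC (suc n) ⟩
    zₚ (suc n)                              ≈⟨ zₚ-suc n ⟩
    oneₚ n                                  ∎

corollary7 : ∀ {c ℓ : Level} (K : Field c ℓ) (r : ℕ) .{{_ : NonZero r}}
    (H : IsRationalFunctionField K r) (BC : ℕ → Field.Carrier K) →
    Carlitz.IsBernoulliCarlitz K r H BC →
    ∀ (m : ℕ) → m ≥ 1 →
    Field._≈_ K (BC m)
      (Field._*_ K (Field._*_ K (FieldOps.pow K (Field.-_ K (Field.1# K)) m) (Carlitz.Π K r H m))
        (FieldOps.det K m (Carlitz.hessenberg K r H m)))
corollary7 K r H BC isBC m _ = begin
  BC m                                  ≈⟨ x≈x*y⁻¹*y (BC m) (Π≉0 m) ⟩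
  (BC m * Π m ⁻¹) * Π m
    ≈⟨ *-congʳ (·ₚ-inverse-unique {b = δ*} δ*₀≈1 (bernoulliCarlitz·δ*≈1 isBC) signedDet·δ*≈1 m) ⟩
  signedDet m * Π m
    ≈⟨ solve 3 (λ σ d π → (σ :* d) :* π := (σ :* π) :* d) refl (sign m) (det m (hessenberg m)) (Π m) ⟩
  (sign m * Π m) * det m (hessenberg m) ∎
  where
  open Field K
  open FieldOps K
  open FieldProperties K
  open Carlitz K r H
  open CarlitzProperties K r H
  open import Algebra.Solver.Ring.NaturalCoefficients.Default commutativeSemiring using (solve; _:+_; _:*_; _:=_)
  open import Relation.Binary.Reasoning.Setoid setoid
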